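{- Let $\mathcal T$ be a tangle of order $k$ in a connectivity system $(E,\lambda)$, and let $X$ be a $\mathcal T$-strong $k$-separating set. If $(X_i)_{i=1}^m$ is a partial $k$-sequence for $X$, then $X\cup\bigcup_{i=1}^m X_i\subseteq\mathrm{fcl}_{\mathcal T}(X)$.
   Context: A connectivity system is a pair $(E,\lambda)$ with $E$ finite and $\lambda$ an integer-valued symmetric ($\lambda(X)=\lambda(E-X)$) submodular function on subsets of $E$. $X$ is $k$-separating if $\lambda(X)\le k$. A tangle of order $k$ is a collection $\mathcal T$ of subsets of $E$ with (T1) $\lambda(A)<k$ for $A\in\mathcal T$; (T2) if $\lambda(A)\le k-1$ then $A\in\mathcal T$ or $E-A\in\mathcal T$; (T3) no three members have union $E$; (T4) $E-\{e\}\notin\mathcal T$. $X$ is $\mathcal T$-weak if contained in a member of $\mathcal T$, else $\mathcal T$-strong. A $\mathcal T$-strong $k$-separating set $X$ is fully closed if there is no non-empty $\mathcal T$-weak $Y\subseteq E-X$ with $X\cup Y$ $k$-separating; $\mathrm{fcl}_{\mathcal T}(X)$ is the intersection of all fully closed $k$-separating sets containing $X$. A partial $k$-sequence for a $\mathcal T$-strong $k$-separating set $X$ is a sequence $(X_i)_{i=1}^m$ of pairwise disjoint non-empty $\mathcal T$-weak subsets of $E-X$ such that $X\cup\bigcup_{i=1}^j X_i$ is $k$-separating for every $j\in\{1,\dots,m\}$. -}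

module Defs where

open import Data.Nat using (ℕ; suc; zero)
open import Data.Fin using (Fin)
open import Data.Fin.Subset
  using (Subset; _∈_; _⊆_; ∁; _∩_; _∪_; ⋃; ⁅_⁆; ⊤; Nonempty; Empty)
open import Data.Integer using (ℤ; _<_; _≤_; _+_; _-_; 1ℤ)
open import Data.List using (List; length; take)
open import Data.List.Relation.Unary.All using (All)
open import Data.List.Relation.Unary.AllPairs using (AllPairs)
open import Data.Product using (Σ; _×_)
open import Data.Sum using (_⊎_)
open import Relation.Nullary using (¬_)
open import Relation.Binary.PropositionalEquality using (_≡_)

record ConnectivitySystem (n : ℕ) : Set where
  field
    λc         : Subset n → ℤ
    symmetric  : ∀ X → λc X ≡ λc (∁ X)
    submodular : ∀ X Y → λc (X ∪ Y) + λc (X ∩ Y) ≤ λc X + λc Y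

module _ {n : ℕ} (C : ConnectivitySystem n) where
  open ConnectivitySystem C

  Separating : ℤ → Subset n → Set
  Separating k X = λc X ≤ k

  record IsTangle (k : ℤ) (𝒯 : Subset n → Set) : Set where
    field
      T1 : ∀ A → 𝒯 A → λc A < k
      T2 : ∀ A → λc A ≤ k - 1ℤ → 𝒯 A ⊎ 𝒯 (∁ A)
      T3 : ∀ A B C → 𝒯 A → 𝒯 B → 𝒯 C → ¬ ((A ∪ B) ∪ C ≡ ⊤)
      T4 : ∀ e → ¬ 𝒯 (∁ ⁅ e ⁆)

  module _ (k : ℤ) (𝒯 : Subset n → Set) where

    Weak : Subset n → Set
    Weak X = Σ (Subset n) (λ A → 𝒯 A × X ⊆ A)

    Strong : Subset n → Set
    Strong X = ¬ Weak X

    FullyClosed : Subset n → Set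
    FullyClosed X =
      Strong X × Separating k X ×
      (∀ Y → Nonempty Y → Weak Y → Y ⊆ ∁ X → ¬ Separating k (X ∪ Y))

    _∈fcl_ : Fin n → Subset n → Set
    e ∈fcl X = ∀ Z → FullyClosed Z → X ⊆ Z → e ∈ Z

    _⊆fcl_ : Subset n → Subset n → Set
    Y ⊆fcl X = ∀ {e} → e ∈ Y → e ∈fcl X

    Disjoint : Subset n → Subset n → Set
    Disjoint A B = Empty (A ∩ B)

    record IsPartialSequence (X : Subset n) (Xs : List (Subset n)) : Set where
      field
        disjoint : AllPairs Disjoint Xs
        nonempty : All Nonempty Xs
        weak     : All Weak Xs
        outside  : All (λ Xi → Xi ⊆ ∁ X) Xs
        prefixes : ∀ j → 1 Data.Nat.≤ j → j Data.Nat.≤ length Xs →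
                     Separating k (X ∪ ⋃ (take j Xs))

-- Fix a fully closed set Z ⊇ X; we must show X ∪ X₁ ∪ … ∪ X_m ⊆ Z.
-- The heart of the argument is a one-step absorption lemma: if W ⊆ Z
-- is 𝒯-strong, Y is 𝒯-weak and W ∪ Y is k-separating, then Y ⊆ Z.
-- For e ∈ Y − Z put D = Z ∩ (W ∪ Y), a 𝒯-strong set (it contains W).
--   * If λ(D) < k, the tangle axiom (T2) puts E − D in 𝒯, so E − Z is
--     a non-empty 𝒯-weak set; but Z ∪ (E − Z) = E is k-separating
--     (λ(E) is the minimum of λ), contradicting that Z is fully closed.
--   * If λ(D) ≥ k, submodularity makes Z ∪ W ∪ Y = Z ∪ (Y − Z)
--     k-separating, and Y − Z is non-empty and 𝒯-weak: again a
--     contradiction.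
-- Applying this along the sequence, with W = X ∪ X₁ ∪ … ∪ X_{i-1}
-- (strong because it contains X), absorbs every X_i into Z.
module Submission where

open import Defs
open import Data.Nat using (ℕ)
open import Data.Integer using (ℤ)
open import Data.Fin.Subset using (Subset; _∪_; ⋃)
open import Data.List using (List)

open import Data.Nat as ℕ using (suc; s≤s; z≤n)
open import Data.Fin.Subset using (_⊆_; ∁; _∩_; ⊤; ⊥; Nonempty)
open import Data.Fin.Subset.Properties
  using (_∈?_; ⊆-refl; ⊆-antisym; ⊆-trans; p⊆p∪q; p∩q⊆p; p∩q⊆q; x∈p∪q⁻;
         x∈p∩q⁺; x∉p⇒x∈∁p; p⊆q⇒∁p⊇∁q; p∪∁p≡⊤; ∩-inverseʳ;
         ∪-assoc; ∪-identityˡ; ∪-identityʳ; ∪-distribˡ-∩; ∩-identityʳ)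
open import Data.Integer using (_+_; _<_; _≤_; -1ℤ; _<?_)
open import Data.Integer.Properties
  using (≮⇒≥; <⇒≱; +-mono-<; +-mono-<-≤; +-mono-≤; +-comm; i<j⇒i≤pred[j]; ≤-trans)
open import Data.List using ([]; _∷_; length; take)
open import Data.List.Relation.Unary.All using (All; []; _∷_)
open import Data.Product using (_×_; _,_; proj₁; proj₂)
open import Data.Sum using (inj₁; inj₂)
open import Data.Empty using (⊥-elim)
open import Relation.Nullary using (yes; no; contradiction)
open import Relation.Binary.PropositionalEquality
  using (_≡_; sym; cong; subst; subst₂; module ≡-Reasoning)
open ≡-Reasoning

∁⊥≡⊤ : ∀ {n} → ∁ (⊥ {n}) ≡ ⊤
∁⊥≡⊤ = begin
  ∁ ⊥      ≡⟨ sym (∪-identityˡ (∁ ⊥)) ⟩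
  ⊥ ∪ ∁ ⊥  ≡⟨ p∪∁p≡⊤ ⊥ ⟩
  ⊤        ∎

p∪q≡p∪[q∩∁p] : ∀ {n} (Z Y : Subset n) → Z ∪ Y ≡ Z ∪ (Y ∩ ∁ Z)
p∪q≡p∪[q∩∁p] Z Y = sym (begin
  Z ∪ (Y ∩ ∁ Z)          ≡⟨ ∪-distribˡ-∩ Z Y (∁ Z) ⟩
  (Z ∪ Y) ∩ (Z ∪ ∁ Z)    ≡⟨ cong ((Z ∪ Y) ∩_) (p∪∁p≡⊤ Z) ⟩
  (Z ∪ Y) ∩ ⊤            ≡⟨ ∩-identityʳ (Z ∪ Y) ⟩
  Z ∪ Y                  ∎)

∪-least : ∀ {n} {A B Z : Subset n} → A ⊆ Z → B ⊆ Z → A ∪ B ⊆ Z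
∪-least {A = A} {B} A⊆Z B⊆Z x∈ with x∈p∪q⁻ A B x∈
... | inj₁ x∈A = A⊆Z x∈A
... | inj₂ x∈B = B⊆Z x∈B

⊆⇒∪-absorbed : ∀ {n} {W Z : Subset n} → W ⊆ Z → Z ∪ W ≡ Z
⊆⇒∪-absorbed W⊆Z = ⊆-antisym (∪-least ⊆-refl W⊆Z) (p⊆p∪q _)

module Connectivity {n : ℕ} (C : ConnectivitySystem n) where
  open ConnectivitySystem C

  -- λ(E) = λ(∅) is the least value of λ: submodularity on Z, E − Z gives
  -- λ(E) + λ(∅) ≤ λ(Z) + λ(E − Z), i.e. 2 λ(E) ≤ 2 λ(Z).
  λ⊤-minimum : ∀ Z → λc ⊤ ≤ λc Z
  λ⊤-minimum Z = ≮⇒≥ (λ λZ<λ⊤ → <⇒≱ (+-mono-< λZ<λ⊤ λZ<λ⊤) twice≤)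
    where
    twice≤ : λc ⊤ + λc ⊤ ≤ λc Z + λc Z
    twice≤ = subst₂ (λ a b → a + b ≤ λc Z + λc Z)
      (cong λc (p∪∁p≡⊤ Z))
      (begin
        λc (Z ∩ ∁ Z)  ≡⟨ cong λc (∩-inverseʳ Z) ⟩
        λc ⊥          ≡⟨ symmetric ⊥ ⟩
        λc (∁ ⊥)      ≡⟨ cong λc ∁⊥≡⊤ ⟩
        λc ⊤          ∎)
      (subst (λ c → λc (Z ∪ ∁ Z) + λc (Z ∩ ∁ Z) ≤ λc Z + c)
        (sym (symmetric Z)) (submodular Z (∁ Z)))

  uncross : ∀ {k} A B → Separating C k A → Separating C k B →
            k ≤ λc (A ∩ B) → Separating C k (A ∪ B)
  uncross {k} A B A-sep B-sep k≤λ∩ = ≮⇒≥ (λ k<λ∪ →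
    <⇒≱ (+-mono-<-≤ k<λ∪ k≤λ∩) (≤-trans (submodular A B) (+-mono-≤ A-sep B-sep)))

  large-meet⇒separating : ∀ {k Z W Y} → Separating C k Z → W ⊆ Z →
                          Separating C k (W ∪ Y) → k ≤ λc (Z ∩ (W ∪ Y)) →
                          Separating C k (Z ∪ (Y ∩ ∁ Z))
  large-meet⇒separating {k} {Z} {W} {Y} Z-sep W⊆Z WY-sep k≤λD =
    subst (Separating C k) Z∪WY≡Z∪[Y−Z] (uncross Z (W ∪ Y) Z-sep WY-sep k≤λD)
    where
    Z∪WY≡Z∪[Y−Z] : Z ∪ (W ∪ Y) ≡ Z ∪ (Y ∩ ∁ Z)
    Z∪WY≡Z∪[Y−Z] = begin
      Z ∪ (W ∪ Y)    ≡⟨ sym (∪-assoc Z W Y) ⟩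
      (Z ∪ W) ∪ Y    ≡⟨ cong (_∪ Y) (⊆⇒∪-absorbed W⊆Z) ⟩
      Z ∪ Y          ≡⟨ p∪q≡p∪[q∩∁p] Z Y ⟩
      Z ∪ (Y ∩ ∁ Z)  ∎

module Weakness {n : ℕ} (C : ConnectivitySystem n) (k : ℤ) (𝒯 : Subset n → Set) where

  weak-⊆ : ∀ {X Y} → Y ⊆ X → Weak C k 𝒯 X → Weak C k 𝒯 Y
  weak-⊆ Y⊆X (A , A∈𝒯 , X⊆A) = A , A∈𝒯 , ⊆-trans Y⊆X X⊆A

  strong-⊇ : ∀ {X W} → X ⊆ W → Strong C k 𝒯 X → Strong C k 𝒯 W
  strong-⊇ X⊆W X-strong W-weak = X-strong (weak-⊆ X⊆W W-weak)

module Prefixes {n : ℕ} (C : ConnectivitySystem n) (k : ℤ) where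

  PrefixesSeparating : Subset n → List (Subset n) → Set
  PrefixesSeparating W L =
    ∀ j → 1 ℕ.≤ j → j ℕ.≤ length L → Separating C k (W ∪ ⋃ (take j L))

  prefixes-∷ : ∀ {W Y L} → PrefixesSeparating W (Y ∷ L) →
               Separating C k (W ∪ Y) × PrefixesSeparating (W ∪ Y) L
  prefixes-∷ {W} {Y} {L} prefixes =
    subst (λ S → Separating C k (W ∪ S)) (∪-identityʳ Y) (prefixes 1 (s≤s z≤n) (s≤s z≤n)) ,
    λ j _ j≤ → subst (Separating C k) (sym (∪-assoc W Y (⋃ (take j L))))
                 (prefixes (suc j) (s≤s z≤n) (s≤s j≤))

module FullyClosedSets {n : ℕ} (C : ConnectivitySystem n) (k : ℤ)
  (𝒯 : Subset n → Set) (tangle : IsTangle C k 𝒯) where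
  open ConnectivitySystem C
  open IsTangle tangle
  open Connectivity C
  open Weakness C k 𝒯
  open Prefixes C k

  strong-small⇒∁∈𝒯 : ∀ D → λc D < k → Strong C k 𝒯 D → 𝒯 (∁ D)
  strong-small⇒∁∈𝒯 D λD<k D-strong
    with T2 D (subst (λc D ≤_) (+-comm -1ℤ k) (i<j⇒i≤pred[j] λD<k))
  ... | inj₁ D∈𝒯  = ⊥-elim (D-strong (D , D∈𝒯 , ⊆-refl))
  ... | inj₂ ∁D∈𝒯 = ∁D∈𝒯

  -- The complement of a fully closed set is 𝒯-strong unless it is empty:
  -- otherwise adjoining it to Z would give the k-separating set E.
  fullyClosed-∁-strong : ∀ {Z} → FullyClosed C k 𝒯 Z →
                         Nonempty (∁ Z) → Strong C k 𝒯 (∁ Z)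
  fullyClosed-∁-strong {Z} (_ , Z-sep , closed) ∁Z-nonempty ∁Z-weak =
    closed (∁ Z) ∁Z-nonempty ∁Z-weak ⊆-refl
      (subst (λ S → λc S ≤ k) (sym (p∪∁p≡⊤ Z)) (≤-trans (λ⊤-minimum Z) Z-sep))

  -- If the meet D = Z ∩ (W ∪ Y) of Z with a superset of the 𝒯-strong
  -- W ⊆ Z has λ(D) < k, then E − D ∈ 𝒯, so E − Z ⊆ E − D is 𝒯-weak.
  small-meet⇒∁-weak : ∀ {Z W Y} → Strong C k 𝒯 W → W ⊆ Z →
                      λc (Z ∩ (W ∪ Y)) < k → Weak C k 𝒯 (∁ Z)
  small-meet⇒∁-weak {Z} {W} {Y} W-strong W⊆Z λD<k =
    ∁ D , strong-small⇒∁∈𝒯 D λD<k D-strong , p⊆q⇒∁p⊇∁q (p∩q⊆p Z (W ∪ Y))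
    where
    D = Z ∩ (W ∪ Y)
    D-strong : Strong C k 𝒯 D
    D-strong = strong-⊇ (λ w → x∈p∩q⁺ (W⊆Z w , p⊆p∪q Y w)) W-strong

  -- An element e ∈ Y − Z
  -- would make E − Z (if λ(D) < k) or Y − Z (if λ(D) ≥ k) a non-empty
  -- 𝒯-weak set extending Z to a k-separating set.
  absorb : ∀ {Z W Y} → FullyClosed C k 𝒯 Z → Strong C k 𝒯 W → W ⊆ Z →
           Weak C k 𝒯 Y → Separating C k (W ∪ Y) → Y ⊆ Z
  absorb {Z} {W} {Y} fc@(_ , Z-sep , closed) W-strong W⊆Z Y-weak WY-sep {e} e∈Y
    with e ∈? Z
  ... | yes e∈Z = e∈Z
  ... | no e∉Z with λc (Z ∩ (W ∪ Y)) <? k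
  ...   | yes λD<k = contradiction (small-meet⇒∁-weak W-strong W⊆Z λD<k)
                       (fullyClosed-∁-strong fc (e , x∉p⇒x∈∁p e∉Z))
  ...   | no λD≮k = contradiction
                      (large-meet⇒separating Z-sep W⊆Z WY-sep (≮⇒≥ λD≮k))
                      (closed (Y ∩ ∁ Z) (e , x∈p∩q⁺ (e∈Y , x∉p⇒x∈∁p e∉Z))
                        (weak-⊆ (p∩q⊆p Y (∁ Z)) Y-weak) (p∩q⊆q Y (∁ Z)))

  absorb-sequence : ∀ {Z W} L → FullyClosed C k 𝒯 Z → Strong C k 𝒯 W → W ⊆ Z →
                    All (Weak C k 𝒯) L → PrefixesSeparating W L → W ∪ ⋃ L ⊆ Z
  absorb-sequence {Z} {W} [] _ _ W⊆Z [] _ =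
    subst (_⊆ Z) (sym (∪-identityʳ W)) W⊆Z
  absorb-sequence {Z} {W} (Y ∷ L) fc W-strong W⊆Z (Y-weak ∷ L-weak) prefixes =
    subst (_⊆ Z) (∪-assoc W Y (⋃ L))
      (absorb-sequence L fc (strong-⊇ (p⊆p∪q Y) W-strong) WY⊆Z L-weak L-prefixes)
    where
    WY-sep = proj₁ (prefixes-∷ prefixes)
    L-prefixes = proj₂ (prefixes-∷ prefixes)
    WY⊆Z : W ∪ Y ⊆ Z
    WY⊆Z = ∪-least W⊆Z (absorb fc W-strong W⊆Z Y-weak WY-sep)

lemma3p4 : (n : ℕ) (C : ConnectivitySystem n) (k : ℤ) (𝒯 : Subset n → Set) →
    IsTangle C k 𝒯 → (X : Subset n) → Strong C k 𝒯 X → Separating C k X →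
    (Xs : List (Subset n)) → IsPartialSequence C k 𝒯 X Xs →
    _⊆fcl_ C k 𝒯 (X ∪ ⋃ Xs) X
lemma3p4 n C k 𝒯 tangle X X-strong _ Xs sequence e∈ Z Z-closed X⊆Z =
  absorb-sequence Xs Z-closed X-strong X⊆Z
    (IsPartialSequence.weak sequence) (IsPartialSequence.prefixes sequence) e∈
  where open FullyClosedSets C k 𝒯 tangle
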